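{- In the sparse-DAG procedure described in the context, immediately after the update of a vertex $v$ in the forward pass, $INC[v]=1+\max_{(u,v)\in E} INC[u]$ (the maximum over an empty set being $0$). Analogously, immediately after the update of $v$ in the backward pass, $DEC[v]=1+\max DEC[w]$ over all $w$ such that $(v,w)$ is an edge of the decreasing half.
   Context: $A[0..n-1]$, $B[0..m-1]$ are sequences over a totally ordered alphabet. Vertices are matches $V=\{(i,j):A[i]=B[j]\}$. Increasing edges: $E=\{((i,j),(i',j')): i<i', j<j', A[i]<A[i']\}$; decreasing edges: $((i,j),(i',j'))$ with $i<i'$, $j<j'$, $A[i]>A[i']$. Vertices are listed in MATCHES sorted by $(i\uparrow,j\uparrow)$. For $v=(i,j)$: $r_J(v)$ is one plus the rank of $j$ among sorted distinct $j$-values in MATCHES; $r_V(v)$ is the 1-based rank of $A[i]$ among sorted distinct values of $A\cup B$; $MAX_J=\max r_J$, $\widehat r_J(v)=MAX_J-r_J(v)+1$. A 2-D range tree supports Update(point $(x,y)$, value) and Query$(x,y)$ returning the maximum value stored at points $(x',y')$ with $x'\le x$, $y'\le y$ (0 if none). Forward pass: with an empty tree $RT_{inc}$, for each $v$ in MATCHES order: $INC[v]\gets$ Query$(RT_{inc},r_J(v)-1,r_V(v)-1)+1$, then Update$(RT_{inc},(r_J(v),r_V(v)),INC[v])$. Backward pass: with an empty tree $RT_{dec}$, for each $v$ in reverse MATCHES order: $DEC[v]\gets$ Query$(RT_{dec},\widehat r_J(v)-1,r_V(v)-1)+1$, then Update$(RT_{dec},(\widehat r_J(v),r_V(v)),DEC[v])$.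 -}

module Defs where

open import Data.Nat using (ℕ; zero; suc; _+_; _∸_; _⊔_; _≤_; _<_; _≤?_; _<?_)
import Data.Nat as ℕ
open import Data.Fin using (Fin; toℕ)
import Data.Fin as Fin
open import Data.List using (List; []; _∷_; map; filter; concatMap; allFin; deduplicate; length; reverse; foldr; _++_)
open import Data.Product using (_×_; _,_; proj₁; proj₂)
open import Data.Product.Properties using (≡-dec)
open import Relation.Nullary using (Dec; yes; no; does)
open import Relation.Nullary.Decidable using (_×-dec_)
open import Relation.Binary.PropositionalEquality using (_≡_)
import Data.Bool

maxList : List ℕ → ℕ
maxList = foldr _⊔_ 0

-- Abstract 2-D range tree (max-dominance structure), modelled by the
-- multiset of stored (point, value) pairs.
RangeTree : Set
RangeTree = List ((ℕ × ℕ) × ℕ)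

emptyRT : RangeTree
emptyRT = []

updateRT : RangeTree → ℕ × ℕ → ℕ → RangeTree
updateRT t p val = (p , val) ∷ t

queryRT : RangeTree → ℕ → ℕ → ℕ
queryRT t x y =
  maxList (map proj₂ (filter (λ e → (proj₁ (proj₁ e) ≤? x) ×-dec (proj₂ (proj₁ e) ≤? y)) t))

countDistinctBelow : ℕ → List ℕ → ℕ
countDistinctBelow x l = length (filter (_<? x) (deduplicate ℕ._≟_ l))

module Sparse {n m : ℕ} (A : Fin n → ℕ) (B : Fin m → ℕ) where

  Vtx : Set
  Vtx = Fin n × Fin m

  _≟V_ : (u v : Vtx) → Dec (u ≡ v)
  _≟V_ = ≡-dec Fin._≟_ Fin._≟_

  val : Vtx → ℕ
  val v = A (proj₁ v)

  matches : List Vtx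
  matches = concatMap (λ i → map (i ,_) (filter (λ j → A i ℕ.≟ B j) (allFin m))) (allFin n)

  IncEdge : Vtx → Vtx → Set
  IncEdge u v = (proj₁ u Fin.< proj₁ v) × (proj₂ u Fin.< proj₂ v) × (val u < val v)

  incEdge? : (u v : Vtx) → Dec (IncEdge u v)
  incEdge? u v = (proj₁ u Fin.<? proj₁ v) ×-dec ((proj₂ u Fin.<? proj₂ v) ×-dec (val u <? val v))

  DecEdge : Vtx → Vtx → Set
  DecEdge v w = (proj₁ v Fin.< proj₁ w) × (proj₂ v Fin.< proj₂ w) × (val w < val v)

  decEdge? : (v w : Vtx) → Dec (DecEdge v w)
  decEdge? v w = (proj₁ v Fin.<? proj₁ w) ×-dec ((proj₂ v Fin.<? proj₂ w) ×-dec (val w <? val v))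

  -- r_J(v) = 1 + (0-based) rank of j among the sorted distinct j-values of MATCHES
  rJ : Vtx → ℕ
  rJ v = suc (countDistinctBelow (toℕ (proj₂ v)) (map (λ u → toℕ (proj₂ u)) matches))

  -- r_V(v) = 1-based rank of A[i] among the sorted distinct values of A ∪ B
  rV : Vtx → ℕ
  rV v = suc (countDistinctBelow (val v) (map A (allFin n) ++ map B (allFin m)))

  MAXJ : ℕ
  MAXJ = maxList (map rJ matches)

  rJhat : Vtx → ℕ
  rJhat v = MAXJ ∸ rJ v + 1

  -- forward pass: returns the list of assignments (v , INC[v]) in processing order
  forwardPass : RangeTree → List Vtx → List (Vtx × ℕ)
  forwardPass t [] = []
  forwardPass t (v ∷ vs) =
    let x = queryRT t (rJ v ∸ 1) (rV v ∸ 1) + 1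
    in (v , x) ∷ forwardPass (updateRT t (rJ v , rV v) x) vs

  backwardPass : RangeTree → List Vtx → List (Vtx × ℕ)
  backwardPass t [] = []
  backwardPass t (v ∷ vs) =
    let x = queryRT t (rJhat v ∸ 1) (rV v ∸ 1) + 1
    in (v , x) ∷ backwardPass (updateRT t (rJhat v , rV v) x) vs

  -- value assigned to a vertex (first assignment; 0 if never assigned)
  assigned : List (Vtx × ℕ) → Vtx → ℕ
  assigned [] v = 0
  assigned ((u , x) ∷ rest) v with does (u ≟V v)
  ... | Data.Bool.true = x
  ... | Data.Bool.false = assigned rest v

  INC : Vtx → ℕ
  INC = assigned (forwardPass emptyRT matches)

  DEC : Vtx → ℕ
  DEC = assigned (backwardPass emptyRT (reverse matches))

-- Both passes are one dominance pass that differs only in the point P v at which a vertex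
-- is stored: v receives one plus the largest value stored in the quadrant below P v.  The
-- vertices are processed in (i , j)-lexicographic order, resp. its reverse, along which every
-- edge into v, resp. out of v, starts at an earlier vertex; so when v is queried, the tree
-- holds exactly the final values of the earlier vertices.  Ranks preserve and reflect the
-- order of j-indices and of values (the hat reverses the j-order), hence an earlier vertex
-- lies in the quadrant of v iff it is joined to v by an edge: lexicographically earlier
-- already means a smaller i, since a shared i would force equal values.
module Submission where

open import Defs
open import Data.Nat using (ℕ; _+_; _∸_; _≤_; _<_; _≤?_; _<?_; z≤n; s<s; s<s⁻¹)
open import Data.Nat.Properties
  using (⊔-lub; m≤m⊔n; m≤n⊔m; ≤-trans; ≤-antisym; <-≤-trans; <-irrefl; <⇒≤; ≤∧≢⇒<;
         ≮⇒≥; +-comm; m+n∸n≡m; ∸-monoʳ-<; ∸-cancelʳ-<; <⇒≢; >⇒≢)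
import Data.Nat as ℕ
open import Data.Fin using (Fin; toℕ)
import Data.Fin as Fin
import Data.Fin.Properties as Fin
open import Data.List using (List; []; _∷_; _++_; map; filter; length; reverse; allFin; deduplicate; _ʳ++_)
open import Data.List.Properties using (unfold-reverse)
open import Data.List.Membership.Propositional using (_∈_; _∉_)
open import Data.List.Membership.Propositional.Properties
  using (∈-map⁺; ∈-map⁻; ∈-filter⁺; ∈-filter⁻; ∈-++⁺ˡ; ∈-++⁺ʳ; ∈-++⁻; ∈-∃++;
         ∈-deduplicate⁺; ∈-allFin)
open import Data.List.Relation.Unary.Any using (here; there)
open import Data.List.Relation.Unary.Any.Properties using (reverse⁺; reverse⁻)
open import Data.List.Relation.Unary.All as All using (All; []; _∷_)
import Data.List.Relation.Unary.All.Properties as All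
open import Data.List.Relation.Unary.AllPairs as AllPairs using (AllPairs; []; _∷_)
import Data.List.Relation.Unary.AllPairs.Properties as AllPairs
open import Data.List.Relation.Unary.Unique.Propositional using (Unique)
open import Data.List.Relation.Binary.Subset.Propositional using (_⊆_)
import Data.List.Relation.Binary.Sublist.Propositional as Sublist
import Data.List.Relation.Binary.Sublist.Propositional.Properties as Sublist
open import Data.List.Relation.Binary.Equality.Propositional using (≋⇒≡)
open import Data.Product using (_×_; _,_; proj₁; proj₂; map₁)
open import Data.Product.Relation.Binary.Lex.Strict using (×-Lex; ×-asymmetric)
open import Data.Sum using (inj₁; inj₂)
open import Data.Empty using (⊥-elim)
open import Relation.Nullary using (Dec; yes; no)
open import Relation.Nullary.Decidable using (_×-dec_)
open import Relation.Unary using (Decidable)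
open import Relation.Binary using (Rel; Asymmetric)
open import Relation.Binary.PropositionalEquality
  using (_≡_; _≢_; refl; sym; cong; subst; subst₂; resp₂; module ≡-Reasoning)
open import Function using (_∘_; flip; id; _⇔_; mk⇔; Equivalence)

import Function.Properties.Equivalence as ⇔
open Equivalence using (to; from)

private
  variable
    X : Set
    R : Rel X _
    x y k : ℕ
    xs ys : List ℕ

maxList-ub : x ∈ xs → x ≤ maxList xs
maxList-ub {xs = x ∷ xs} (here refl) = m≤m⊔n x (maxList xs)
maxList-ub {xs = y ∷ xs} (there x∈xs) = ≤-trans (maxList-ub x∈xs) (m≤n⊔m y (maxList xs))

maxList-lub : All (_≤ k) xs → maxList xs ≤ k
maxList-lub [] = z≤n
maxList-lub (x≤k ∷ xs≤k) = ⊔-lub x≤k (maxList-lub xs≤k)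

maxList-mono-⊆ : xs ⊆ ys → maxList xs ≤ maxList ys
maxList-mono-⊆ xs⊆ys = maxList-lub (All.tabulate (maxList-ub ∘ xs⊆ys))

maxList-cong-⊆ : xs ⊆ ys → ys ⊆ xs → maxList xs ≡ maxList ys
maxList-cong-⊆ xs⊆ys ys⊆xs = ≤-antisym (maxList-mono-⊆ xs⊆ys) (maxList-mono-⊆ ys⊆xs)

map-filter-⊆ : ∀ {A B : Set} {P Q : A → Set} (f : A → B) (P? : Decidable P) (Q? : Decidable Q)
  {as bs : List A} → (∀ {a} → a ∈ as → P a → a ∈ bs × Q a) →
  map f (filter P? as) ⊆ map f (filter Q? bs)
map-filter-⊆ f P? Q? {as} P⇒Q fa∈ with a , a∈ , refl ← ∈-map⁻ f fa∈ =
  let a∈as , Pa = ∈-filter⁻ P? {xs = as} a∈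
      a∈bs , Qa = P⇒Q a∈as Pa
  in ∈-map⁺ f (∈-filter⁺ Q? a∈bs Qa)

countBelow : ℕ → List ℕ → ℕ
countBelow x D = length (filter (_<? x) D)

filter-<-⊆ : ∀ D → x ≤ y → filter (_<? x) D Sublist.⊆ filter (_<? y) D
filter-<-⊆ D x≤y =
  Sublist.filter⁺ (_<? _) (_<? _) (λ { refl d<x → <-≤-trans d<x x≤y }) (Sublist.⊆-refl {x = D})

countBelow-mono-≤ : ∀ D → x ≤ y → countBelow x D ≤ countBelow y D
countBelow-mono-≤ D x≤y = Sublist.length-mono-≤ (filter-<-⊆ D x≤y)

-- A sublist of full length is the whole list, and the entries below y contain x.
countBelow-mono-< : ∀ {D} → x ∈ D → x < y → countBelow x D < countBelow y D
countBelow-mono-< {x} {y} {D} x∈D x<y = ≤∧≢⇒< (countBelow-mono-≤ D (<⇒≤ x<y)) counts≢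
  where
  counts≢ : countBelow x D ≢ countBelow y D
  counts≢ eq = <-irrefl refl (proj₂ (∈-filter⁻ (_<? x) {xs = D} x∈below-x))
    where
    below-x≡below-y : filter (_<? x) D ≡ filter (_<? y) D
    below-x≡below-y = ≋⇒≡ (Sublist.to-≋ eq (filter-<-⊆ D (<⇒≤ x<y)))

    x∈below-x : x ∈ filter (_<? x) D
    x∈below-x = subst (x ∈_) (sym below-x≡below-y) (∈-filter⁺ (_<? y) x∈D x<y)

countDistinctBelow-<⇔ : ∀ l → x ∈ l → (countDistinctBelow x l < countDistinctBelow y l ⇔ x < y)
countDistinctBelow-<⇔ {x} {y} l x∈l = mk⇔ reflect (countBelow-mono-< (∈-deduplicate⁺ ℕ._≟_ x∈l))
  where
  reflect : countDistinctBelow x l < countDistinctBelow y l → x < y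
  reflect c<c with x <? y
  ... | yes x<y = x<y
  ... | no x≮y =
    ⊥-elim (<-irrefl refl (<-≤-trans c<c (countBelow-mono-≤ (deduplicate ℕ._≟_ l) (≮⇒≥ x≮y))))

m∸n+1≤m∸o+1∸1⇔o<n : ∀ {m n o} → n ≤ m → (m ∸ n + 1 ≤ m ∸ o + 1 ∸ 1 ⇔ o < n)
m∸n+1≤m∸o+1∸1⇔o<n {m} {n} {o} n≤m = mk⇔
  (λ le → ∸-cancelʳ-< (subst₂ _≤_ (+-comm (m ∸ n) 1) (m+n∸n≡m (m ∸ o) 1) le))
  (λ o<n → subst₂ _≤_ (+-comm 1 (m ∸ n)) (sym (m+n∸n≡m (m ∸ o) 1)) (∸-monoʳ-< o<n n≤m))

AllPairs-reverse⁺ : ∀ {xs : List X} → AllPairs R xs → AllPairs (flip R) (reverse xs)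
AllPairs-reverse⁺ [] = []
AllPairs-reverse⁺ {xs = x ∷ xs} (x∼xs ∷ sorted) rewrite unfold-reverse x xs =
  AllPairs.++⁺ (AllPairs-reverse⁺ sorted) ([] ∷ [])
    (All.tabulate (λ y∈ → All.lookup x∼xs (reverse⁻ y∈) ∷ []))

AllPairs-++-∷⁻ : ∀ pre {v : X} {post} → AllPairs R (pre ++ v ∷ post) →
  AllPairs R pre × All (λ u → R u v) pre × All (R v) post
AllPairs-++-∷⁻ [] (v∼post ∷ _) = [] , [] , v∼post
AllPairs-++-∷⁻ (u ∷ pre) (u∼rest ∷ sorted) =
  let sortedPre , pre∼v , v∼post = AllPairs-++-∷⁻ pre sorted
  in All.++⁻ˡ pre u∼rest ∷ sortedPre , All.lookup u∼rest (∈-++⁺ʳ pre (here refl)) ∷ pre∼v , v∼post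

AllPairs-∈-prefix⇔ : Asymmetric R → ∀ pre {v : X} {post u} → AllPairs R (pre ++ v ∷ post) →
  u ∈ pre ++ v ∷ post → (u ∈ pre ⇔ R u v)
AllPairs-∈-prefix⇔ {R = R} asym pre {v} {post} {u} sorted u∈ = mk⇔ (All.lookup pre∼v) before
  where
  pre∼v = proj₁ (proj₂ (AllPairs-++-∷⁻ pre sorted))
  v∼post = proj₂ (proj₂ (AllPairs-++-∷⁻ pre sorted))
  before : R u v → u ∈ pre
  before u<v with ∈-++⁻ pre u∈
  ... | inj₁ u∈pre = u∈pre
  ... | inj₂ (here refl) = ⊥-elim (asym u<v u<v)
  ... | inj₂ (there u∈post) = ⊥-elim (asym u<v (All.lookup v∼post u∈post))

Point : Set
Point = ℕ × ℕ

_inQuadrantOf_ : Point → Point → Set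
p inQuadrantOf q = (proj₁ p ≤ proj₁ q ∸ 1) × (proj₂ p ≤ proj₂ q ∸ 1)

_inQuadrantOf?_ : (p q : Point) → Dec (p inQuadrantOf q)
p inQuadrantOf? q = (proj₁ p ≤? proj₁ q ∸ 1) ×-dec (proj₂ p ≤? proj₂ q ∸ 1)

module _ {n m : ℕ} (A : Fin n → ℕ) (B : Fin m → ℕ) where
  open Sparse A B

  assigned-++-∉ : ∀ O {rest v} → v ∉ map proj₁ O → assigned (O ++ rest) v ≡ assigned rest v
  assigned-++-∉ [] v∉O = refl
  assigned-++-∉ ((u , k) ∷ O) {v = v} v∉O with u ≟V v
  ... | yes refl = ⊥-elim (v∉O (here refl))
  ... | no _ = assigned-++-∉ O (v∉O ∘ there)

  assigned-++-∈ : ∀ O {rest u k} → Unique (map proj₁ O) → (u , k) ∈ O →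
    assigned (O ++ rest) u ≡ k
  assigned-++-∈ ((w , j) ∷ O) {u = u} (w∉O ∷ unique) uk∈ with w ≟V u | uk∈
  ... | yes _ | here refl = refl
  ... | yes refl | there uk∈O = ⊥-elim (All.lookup w∉O (∈-map⁺ proj₁ uk∈O) refl)
  ... | no w≢u | here refl = ⊥-elim (w≢u refl)
  ... | no _ | there uk∈O = assigned-++-∈ O unique uk∈O

  module DominancePass (P : Vtx → Point) where

    query : RangeTree → Vtx → ℕ
    query t v = queryRT t (proj₁ (P v) ∸ 1) (proj₂ (P v) ∸ 1)

    pass : RangeTree → List Vtx → List (Vtx × ℕ)
    pass t [] = []
    pass t (v ∷ vs) = (v , query t v + 1) ∷ pass (updateRT t (P v) (query t v + 1)) vs

    treeAfter : RangeTree → List Vtx → RangeTree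
    treeAfter t pre = map (map₁ P) (pass t pre) ʳ++ t

    pass-++ : ∀ t pre rest → pass t (pre ++ rest) ≡ pass t pre ++ pass (treeAfter t pre) rest
    pass-++ t [] rest = refl
    pass-++ t (v ∷ pre) rest = cong (_ ∷_) (pass-++ _ pre rest)

    pass-vertices : ∀ t vs → map proj₁ (pass t vs) ≡ vs
    pass-vertices t [] = refl
    pass-vertices t (v ∷ vs) = cong (v ∷_) (pass-vertices _ vs)

    query-treeAfter : ∀ {pre} rest v → Unique pre →
      query (treeAfter [] pre) v ≡
        maxList (map (assigned (pass [] pre ++ rest)) (filter (λ u → P u inQuadrantOf? P v) pre))
    query-treeAfter {pre} rest v unique = maxList-cong-⊆ stored⊆ stored⊇
      where
      O = pass [] pre
      value = assigned (O ++ rest)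
      inQ? = λ u → P u inQuadrantOf? P v

      uniqueO : Unique (map proj₁ O)
      uniqueO = subst Unique (sym (pass-vertices [] pre)) unique

      stored : ∀ {u k} → (u , k) ∈ O → u ∈ pre × value u ≡ k
      stored uk∈O =
        subst (_ ∈_) (pass-vertices [] pre) (∈-map⁺ proj₁ uk∈O) , assigned-++-∈ O uniqueO uk∈O

      stored⊆ : map proj₂ (filter (λ e → proj₁ e inQuadrantOf? P v) (treeAfter [] pre)) ⊆
                map value (filter inQ? pre)
      stored⊆ k∈ with _ , e∈ , refl ← ∈-map⁻ proj₂ k∈
                 with e∈T , inQ ← ∈-filter⁻ _ {xs = treeAfter [] pre} e∈
                 with (u , k) , uk∈O , refl ← ∈-map⁻ (map₁ P) (reverse⁻ {xs = map (map₁ P) O} e∈T) =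
        let u∈pre , value≡k = stored uk∈O
        in subst (_∈ _) value≡k (∈-map⁺ value (∈-filter⁺ inQ? u∈pre inQ))

      stored⊇ : map value (filter inQ? pre) ⊆
                map proj₂ (filter (λ e → proj₁ e inQuadrantOf? P v) (treeAfter [] pre))
      stored⊇ k∈ with u , u∈ , refl ← ∈-map⁻ value k∈
                 with u∈pre , inQ ← ∈-filter⁻ inQ? {xs = pre} u∈
                 with _ , uk∈O , refl ← ∈-map⁻ proj₁ (subst (_ ∈_) (sym (pass-vertices [] pre)) u∈pre) =
        subst (_∈ _) (sym (proj₂ (stored uk∈O)))
          (∈-map⁺ proj₂ (∈-filter⁺ _ (reverse⁺ (∈-map⁺ (map₁ P) uk∈O)) inQ))

    pass-correct : ∀ pre {v post} → Unique (pre ++ v ∷ post) →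
      let value = assigned (pass [] (pre ++ v ∷ post)) in
      value v ≡ 1 + maxList (map value (filter (λ u → P u inQuadrantOf? P v) pre))
    pass-correct pre {v} {post} unique rewrite pass-++ [] pre (v ∷ post) = begin
      assigned (O ++ rest) v   ≡⟨ assigned-++-∉ O (v∉pre ∘ subst (_ ∈_) (pass-vertices [] pre)) ⟩
      assigned rest v          ≡⟨ assigned-++-∈ ((v , query T v + 1) ∷ []) ([] ∷ []) (here refl) ⟩
      query T v + 1            ≡⟨ +-comm _ 1 ⟩
      1 + query T v            ≡⟨ cong (1 +_) (query-treeAfter rest v uniquePre) ⟩
      1 + maxList (map (assigned (O ++ rest)) (filter (λ u → P u inQuadrantOf? P v) pre)) ∎
      where
      open ≡-Reasoning
      O = pass [] pre
      T = treeAfter [] pre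
      rest = pass T (v ∷ post)
      uniquePre = proj₁ (AllPairs-++-∷⁻ pre unique)
      v∉pre : v ∉ pre
      v∉pre v∈pre = All.lookup (proj₁ (proj₂ (AllPairs-++-∷⁻ pre unique))) v∈pre refl

    pass-recurrence : Asymmetric R → ∀ {L Ms v} → AllPairs R L → Ms ⊆ L → L ⊆ Ms → v ∈ L →
      {E : Vtx → Set} (E? : Decidable E) → (∀ {u} → u ∈ L → E u ⇔ (R u v × P u inQuadrantOf P v)) →
      assigned (pass [] L) v ≡ 1 + maxList (map (assigned (pass [] L)) (filter E? Ms))
    pass-recurrence {R = R} asym {Ms = Ms} {v} sorted Ms⊆L L⊆Ms v∈L {E} E? edge⇔
      with pre , post , refl ← ∈-∃++ v∈L = begin
        value v
          ≡⟨ pass-correct pre (AllPairs.map (λ { r refl → asym r r }) sorted) ⟩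
        1 + maxList (map value (filter inQ? pre))
          ≡⟨ cong (1 +_) (maxList-cong-⊆ (map-filter-⊆ value inQ? E? edge)
                                          (map-filter-⊆ value E? inQ? earlierInQ)) ⟩
        1 + maxList (map value (filter E? Ms))
          ∎
      where
      open ≡-Reasoning
      value = assigned (pass [] (pre ++ v ∷ post))
      inQ? = λ u → P u inQuadrantOf? P v
      earlier⇔ : ∀ {u} → u ∈ pre ++ v ∷ post → (u ∈ pre ⇔ R u v)
      earlier⇔ = AllPairs-∈-prefix⇔ asym pre sorted


      edge : ∀ {u} → u ∈ pre → P u inQuadrantOf P v → u ∈ Ms × E u
      edge u∈pre inQ = let u∈L = ∈-++⁺ˡ u∈pre in
        L⊆Ms u∈L , from (edge⇔ u∈L) (to (earlier⇔ u∈L) u∈pre , inQ)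

      earlierInQ : ∀ {u} → u ∈ Ms → E u → u ∈ pre × P u inQuadrantOf P v
      earlierInQ u∈Ms e = let u∈L = Ms⊆L u∈Ms ; r , inQ = to (edge⇔ u∈L) e in
        from (earlier⇔ u∈L) r , inQ

  forwardPoint backwardPoint : Vtx → Point
  forwardPoint v = rJ v , rV v
  backwardPoint v = rJhat v , rV v

  forwardPass≡pass : ∀ t vs → forwardPass t vs ≡ DominancePass.pass forwardPoint t vs
  forwardPass≡pass t [] = refl
  forwardPass≡pass t (v ∷ vs) = cong (_ ∷_) (forwardPass≡pass _ vs)

  backwardPass≡pass : ∀ t vs → backwardPass t vs ≡ DominancePass.pass backwardPoint t vs
  backwardPass≡pass t [] = refl
  backwardPass≡pass t (v ∷ vs) = cong (_ ∷_) (backwardPass≡pass _ vs)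

  _<ₗₑₓ_ : Rel Vtx _
  _<ₗₑₓ_ = ×-Lex _≡_ Fin._<_ Fin._<_

  <ₗₑₓ-asym : Asymmetric _<ₗₑₓ_
  <ₗₑₓ-asym =
    ×-asymmetric {_<₁_ = Fin._<_ {n}} {_<₂_ = Fin._<_ {m}} sym (resp₂ Fin._<_) Fin.<-asym Fin.<-asym

  <ₗₑₓ⇒<ᵢ : ∀ {u w} → u <ₗₑₓ w → val u ≢ val w → proj₁ u Fin.< proj₁ w
  <ₗₑₓ⇒<ᵢ (inj₁ i<i') _ = i<i'
  <ₗₑₓ⇒<ᵢ (inj₂ (i≡i' , _)) val≢ = ⊥-elim (val≢ (cong A i≡i'))

  matches-sorted : AllPairs _<ₗₑₓ_ matches
  matches-sorted =
    AllPairs.concat⁺ (All.map⁺ (All.tabulate⁺ row-sorted)) (AllPairs.map⁺ (AllPairs.tabulate⁺-< rows-ordered))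
    where
    row : Fin n → List Vtx
    row i = map (i ,_) (filter (λ j → A i ℕ.≟ B j) (allFin m))

    row-index : ∀ {i u} → u ∈ row i → proj₁ u ≡ i
    row-index {i} u∈ with _ , _ , refl ← ∈-map⁻ (i ,_) u∈ = refl

    row-sorted : ∀ i → AllPairs _<ₗₑₓ_ (row i)
    row-sorted i =
      AllPairs.map⁺ (AllPairs.filter⁺ _ (AllPairs.tabulate⁺-< (λ j<j' → inj₂ (refl , j<j'))))

    rows-ordered : ∀ {i i'} → i Fin.< i' → All (λ u → All (u <ₗₑₓ_) (row i')) (row i)
    rows-ordered i<i' = All.tabulate λ u∈ → All.tabulate λ w∈ →
      inj₁ (subst₂ Fin._<_ (sym (row-index u∈)) (sym (row-index w∈)) i<i')

  rJ≤rJ∸1⇔ : ∀ {u v} → u ∈ matches → (rJ u ≤ rJ v ∸ 1 ⇔ proj₂ u Fin.< proj₂ v)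
  rJ≤rJ∸1⇔ u∈ = countDistinctBelow-<⇔ _ (∈-map⁺ (toℕ ∘ proj₂) u∈)

  rV≤rV∸1⇔ : ∀ {u v} → rV u ≤ rV v ∸ 1 ⇔ val u < val v
  rV≤rV∸1⇔ {u} = countDistinctBelow-<⇔ _ (∈-++⁺ˡ (∈-map⁺ A (∈-allFin (proj₁ u))))

  rJhat≤rJhat∸1⇔ : ∀ {u v} → u ∈ matches → v ∈ matches →
    (rJhat u ≤ rJhat v ∸ 1 ⇔ proj₂ v Fin.< proj₂ u)
  rJhat≤rJhat∸1⇔ {u} u∈ v∈ =
    ⇔.trans (m∸n+1≤m∸o+1∸1⇔o<n (maxList-ub (∈-map⁺ rJ u∈)))
            (⇔.trans (mk⇔ s<s⁻¹ s<s) (rJ≤rJ∸1⇔ {v = u} v∈))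

  IncEdge⇔ : ∀ {u v} → u ∈ matches →
    IncEdge u v ⇔ (u <ₗₑₓ v × forwardPoint u inQuadrantOf forwardPoint v)
  IncEdge⇔ {u} {v} u∈ = mk⇔
    (λ (i< , j< , a<) → inj₁ i< , from rJ⇔ j< , from rV⇔ a<)
    (λ (u<v , rJ≤ , rV≤) → let a< = to rV⇔ rV≤ in <ₗₑₓ⇒<ᵢ u<v (<⇒≢ a<) , to rJ⇔ rJ≤ , a<)
    where
    rJ⇔ = rJ≤rJ∸1⇔ {v = v} u∈
    rV⇔ = rV≤rV∸1⇔ {u} {v}

  DecEdge⇔ : ∀ {u v} → u ∈ matches → v ∈ matches →
    DecEdge v u ⇔ (v <ₗₑₓ u × backwardPoint u inQuadrantOf backwardPoint v)
  DecEdge⇔ {u} {v} u∈ v∈ = mk⇔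
    (λ (i< , j< , a<) → inj₁ i< , from rJhat⇔ j< , from rV⇔ a<)
    (λ (v<u , rJhat≤ , rV≤) → let a< = to rV⇔ rV≤ in <ₗₑₓ⇒<ᵢ v<u (>⇒≢ a<) , to rJhat⇔ rJhat≤ , a<)
    where
    rJhat⇔ = rJhat≤rJhat∸1⇔ u∈ v∈
    rV⇔ = rV≤rV∸1⇔ {u} {v}

  INC-recurrence : ∀ v → v ∈ matches →
    INC v ≡ 1 + maxList (map INC (filter (λ u → incEdge? u v) matches))
  INC-recurrence v v∈ rewrite cong assigned (forwardPass≡pass [] matches) =
    DominancePass.pass-recurrence forwardPoint <ₗₑₓ-asym matches-sorted id id v∈
      (λ u → incEdge? u v) IncEdge⇔

  DEC-recurrence : ∀ v → v ∈ matches →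
    DEC v ≡ 1 + maxList (map DEC (filter (λ w → decEdge? v w) matches))
  DEC-recurrence v v∈ rewrite cong assigned (backwardPass≡pass [] (reverse matches)) =
    DominancePass.pass-recurrence backwardPoint (flip <ₗₑₓ-asym) {Ms = matches}
      (AllPairs-reverse⁺ matches-sorted) reverse⁺ reverse⁻ (reverse⁺ v∈)
      (λ w → decEdge? v w) (λ u∈ → DecEdge⇔ (reverse⁻ u∈) v∈)

mainTheorem9 : {n m : ℕ} (A : Fin n → ℕ) (B : Fin m → ℕ) →
    (∀ v → v ∈ Sparse.matches A B →
      Sparse.INC A B v ≡ 1 + maxList (map (Sparse.INC A B) (filter (λ u → Sparse.incEdge? A B u v) (Sparse.matches A B))))
    × (∀ v → v ∈ Sparse.matches A B →
      Sparse.DEC A B v ≡ 1 + maxList (map (Sparse.DEC A B) (filter (λ w → Sparse.decEdge? A B v w) (Sparse.matches A B))))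
mainTheorem9 A B = INC-recurrence A B , DEC-recurrence A B
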